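{- Let $\alpha,\alpha'\in\mathcal{NCP}(kn)$ and $\beta,\beta'\in\mathcal{NCP}(ln)$. If $(\alpha,\beta)$ is $n$-admissible and $\alpha'\mid\alpha$, $\beta'\mid\beta$, then $(\alpha',\beta')$ is $n$-admissible. Conversely, if $(\alpha,\beta)$ is not $n$-admissible and $\alpha\mid\alpha'$, $\beta\mid\beta'$, then $(\alpha',\beta')$ is not $n$-admissible.
   Context: A partition of $[m]=\{1,\dots,m\}$ is noncrossing if there are no two distinct blocks $B,C$ and $a<b<c<d$ with $a,c\in B$, $b,d\in C$. $\mathcal{NCP}(m)$ is the set of noncrossing partitions of $[m]$, ordered by refinement: $\pi\mid\mu$ iff every block of $\pi$ is contained in a block of $\mu$. For $\alpha\in\mathcal{NCP}(kn)$, $\beta\in\mathcal{NCP}(ln)$, the $n$-perfect shuffle $\alpha\ast_n\beta$ is the partition $i_k(\alpha)\cup e_l(\beta)$ of $[(k+l)n]$, where $i_k(ak+j)=a(k+l)+j$ ($0\le a\le n-1$, $1\le j\le k$) and $e_l(al+j)=a(k+l)+k+j$ ($0\le a\le n-1$, $1\le j\le l$). The pair $(\alpha,\beta)$ is $n$-admissible if $\alpha\ast_n\beta$ is noncrossing. -}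

module Defs where

open import Data.Nat using (ℕ; _+_; _*_)
open import Data.Fin using (Fin; _<_; splitAt; remQuot; combine)
open import Data.Sum using (_⊎_; inj₁; inj₂)
open import Data.Product using (_,_)
open import Relation.Binary.PropositionalEquality using (_≡_)

-- A (set) partition of [m] = Fin m (0-indexed) is given by a block labelling:
-- positions i and j lie in the same block iff their labels agree.
-- Blocks are the (nonempty) fibres of the labelling.
Labelling : Set → ℕ → Set
Labelling A m = Fin m → A

Partition : ℕ → Set
Partition m = Labelling ℕ m

SameBlock : ∀ {A m} → Labelling A m → Fin m → Fin m → Set
SameBlock π i j = π i ≡ π j

-- noncrossing: no a<b<c<d with a,c in one block B and b,d in a block C ≠ B
NonCrossing : ∀ {A m} → Labelling A m → Set
NonCrossing {m = m} π =
  (a b c d : Fin m) → a < b → b < c → c < d →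
  SameBlock π a c → SameBlock π b d → SameBlock π a b

Refines : ∀ {A B m} → Labelling A m → Labelling B m → Set
Refines {m = m} π μ = (i j : Fin m) → SameBlock π i j → SameBlock μ i j

-- Position a(k+l)+j (0 ≤ a < n, 0 ≤ j < k) carries α's block of ak+j,
-- position a(k+l)+k+j (0 ≤ j < l) carries β's block of al+j.
-- Labels are tagged so that blocks coming from α and from β stay distinct.
shuffle : ∀ {A B} (n k l : ℕ) → Labelling A (n * k) → Labelling B (n * l) →
          Labelling (A ⊎ B) (n * (k + l))
shuffle n k l α β p with remQuot {n} (k + l) p
... | a , r with splitAt k r
...   | inj₁ j = inj₁ (α (combine a j))
...   | inj₂ j = inj₂ (β (combine a j))

Admissible : (n k l : ℕ) → Partition (n * k) → Partition (n * l) → Set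
Admissible n k l α β = NonCrossing (shuffle n k l α β)

{-# OPTIONS --safe #-}
module Submission where

-- Position p of α ∗ₙ β carries the block of α or β at position `source p`, so the
-- shuffle is the tagged sum α ⊎ β pulled back along `source`, which is strictly
-- increasing on each side. A crossing of α′ ∗ₙ β′ between two blocks from the same
-- side is then a crossing of α′ or of β′. A crossing between an α′-block and a
-- β′-block sits inside an α-block and a β-block, which would be a crossing of
-- α ∗ₙ β since blocks from different sides never coincide. The second claim is
-- the contrapositive of the first with the roles of the two pairs exchanged.

open import Defs
open import Data.Nat as ℕ using (ℕ; _+_; _*_)
import Data.Nat.Properties as ℕ
open import Data.Fin using (Fin; toℕ; _<_; _↑ˡ_; _↑ʳ_; splitAt; quotient; remainder; combine)
open import Data.Fin.Properties
  using (toℕ-↑ˡ; toℕ-↑ʳ; toℕ-combine; combine-monoˡ-<; combine-remQuot; splitAt⁻¹-↑ˡ; splitAt⁻¹-↑ʳ; <-cmp; <-asym)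
open import Data.Product using (_×_; _,_; ∃₂)
open import Data.Sum as Sum using (_⊎_; inj₁; inj₂)
open import Data.Sum.Properties using (inj₁-injective; inj₂-injective)
open import Function using (_∘_)
open import Relation.Binary.Definitions using (tri<; tri≈; tri>)
open import Relation.Binary.PropositionalEquality
open import Relation.Nullary using (¬_; contradiction)

private
  variable
    A B : Set
    m m₁ m₂ M M′ : ℕ

NonCrossing-resp-≗ : {π ρ : Labelling A m} → π ≗ ρ → NonCrossing π → NonCrossing ρ
NonCrossing-resp-≗ π≗ρ nc a b c d a<b b<c c<d ac bd =
  trans (sym (π≗ρ a)) (trans (nc a b c d a<b b<c c<d
    (trans (π≗ρ a) (trans ac (sym (π≗ρ c))))
    (trans (π≗ρ b) (trans bd (sym (π≗ρ d))))) (π≗ρ b))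

combine-monoʳ-< : (a : Fin m) {r r′ : Fin M} → r < r′ → combine a r < combine a r′
combine-monoʳ-< {M = M} a {r} {r′} r<r′ =
  subst₂ ℕ._<_ (sym (toℕ-combine a r)) (sym (toℕ-combine a r′)) (ℕ.+-monoʳ-< (M * toℕ a) r<r′)

combine-cancelˡ-< : (a : Fin m) {r r′ : Fin M} → combine a r < combine a r′ → r < r′
combine-cancelˡ-< {M = M} a {r} {r′} lt =
  ℕ.+-cancelˡ-< (M * toℕ a) (toℕ r) (toℕ r′) (subst₂ ℕ._<_ (toℕ-combine a r) (toℕ-combine a r′) lt)

combine-reflects-< : {f : Fin M → Fin M′} → (∀ {r r′} → f r < f r′ → r < r′) →
                     ∀ {a a′ : Fin m} {r r′} → combine a (f r) < combine a′ (f r′) → combine a r < combine a′ r′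
combine-reflects-< {f = f} f-reflects {a} {a′} {r} {r′} lt with <-cmp a a′
... | tri< a<a′ _ _ = combine-monoˡ-< r r′ a<a′
... | tri≈ _ refl _ = combine-monoʳ-< a (f-reflects (combine-cancelˡ-< a lt))
... | tri> _ _ a′<a = contradiction lt (<-asym (combine-monoˡ-< (f r′) (f r) a′<a))

↑ˡ-reflects-< : ∀ {r r′ : Fin M} → r ↑ˡ M′ < r′ ↑ˡ M′ → r < r′
↑ˡ-reflects-< {M′ = M′} {r} {r′} = subst₂ ℕ._<_ (toℕ-↑ˡ r M′) (toℕ-↑ˡ r′ M′)

↑ʳ-reflects-< : ∀ {r r′ : Fin M} → M′ ↑ʳ r < M′ ↑ʳ r′ → r < r′
↑ʳ-reflects-< {M′ = M′} {r} {r′} = ℕ.+-cancelˡ-< M′ (toℕ r) (toℕ r′) ∘ subst₂ ℕ._<_ (toℕ-↑ʳ M′ r) (toℕ-↑ʳ M′ r′)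

Monotoneˡ Monotoneʳ : (Fin m → Fin m₁ ⊎ Fin m₂) → Set
Monotoneˡ σ = ∀ {i j x y} → i < j → σ i ≡ inj₁ x → σ j ≡ inj₁ y → x < y
Monotoneʳ σ = ∀ {i j x y} → i < j → σ i ≡ inj₂ x → σ j ≡ inj₂ y → x < y

NonCrossing-pullback-refine :
  (σ : Fin m → Fin m₁ ⊎ Fin m₂) → Monotoneˡ σ → Monotoneʳ σ →
  {α α′ : Labelling A m₁} {β β′ : Labelling B m₂} →
  NonCrossing α′ → NonCrossing β′ → Refines α′ α → Refines β′ β →
  NonCrossing (Sum.map α β ∘ σ) → NonCrossing (Sum.map α′ β′ ∘ σ)
NonCrossing-pullback-refine σ monoˡ monoʳ nc-α′ nc-β′ α′∣α β′∣β nc a b c d a<b b<c c<d ac bd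
  -- abstracting the instance of nc together with the σ-values exposes its tags
  with σ a in σa | σ b in σb | σ c in σc | σ d in σd | nc a b c d a<b b<c c<d
... | inj₁ x | inj₁ y | inj₁ z | inj₁ w | _ =
  cong inj₁ (nc-α′ x y z w (monoˡ a<b σa σb) (monoˡ b<c σb σc) (monoˡ c<d σc σd)
                  (inj₁-injective ac) (inj₁-injective bd))
... | inj₂ x | inj₂ y | inj₂ z | inj₂ w | _ =
  cong inj₂ (nc-β′ x y z w (monoʳ a<b σa σb) (monoʳ b<c σb σc) (monoʳ c<d σc σd)
                  (inj₂-injective ac) (inj₂-injective bd))
... | inj₁ x | inj₂ y | inj₁ z | inj₂ w | cross
  with () ← cross (cong inj₁ (α′∣α x z (inj₁-injective ac))) (cong inj₂ (β′∣β y w (inj₂-injective bd)))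
... | inj₂ x | inj₁ y | inj₂ z | inj₁ w | cross
  with () ← cross (cong inj₂ (β′∣β x z (inj₂-injective ac))) (cong inj₁ (α′∣α y w (inj₁-injective bd)))
... | inj₁ _ | _ | inj₂ _ | _ | _ with () ← ac
... | inj₂ _ | _ | inj₁ _ | _ | _ with () ← ac
... | _ | inj₁ _ | _ | inj₂ _ | _ with () ← bd
... | _ | inj₂ _ | _ | inj₁ _ | _ with () ← bd

module _ (n k l : ℕ) where

  source : Fin (n * (k + l)) → Fin (n * k) ⊎ Fin (n * l)
  source p = Sum.map (combine a) (combine a) (splitAt k r)
    where a = quotient {n} (k + l) p
          r = remainder {n} (k + l) p

  combine-quotient-remainder : ∀ {p r} → remainder {n} (k + l) p ≡ r → combine (quotient {n} (k + l) p) r ≡ p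
  combine-quotient-remainder {p} refl = combine-remQuot {n} (k + l) p

  shuffle-source : (α : Labelling A (n * k)) (β : Labelling B (n * l)) →
                   shuffle n k l α β ≗ Sum.map α β ∘ source
  shuffle-source α β p with splitAt k (remainder {n} (k + l) p)
  ... | inj₁ j = refl
  ... | inj₂ j = refl

  source-inj₁ : ∀ {p x} → source p ≡ inj₁ x → ∃₂ λ (a : Fin n) (j : Fin k) → combine a (j ↑ˡ l) ≡ p × x ≡ combine a j
  source-inj₁ {p} eq with splitAt k (remainder {n} (k + l) p) in split≡
  ... | inj₁ j with refl ← eq =
    _ , j , combine-quotient-remainder (sym (splitAt⁻¹-↑ˡ split≡)) , refl

  source-inj₂ : ∀ {p y} → source p ≡ inj₂ y → ∃₂ λ (a : Fin n) (j : Fin l) → combine a (k ↑ʳ j) ≡ p × y ≡ combine a j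
  source-inj₂ {p} eq with splitAt k (remainder {n} (k + l) p) in split≡
  ... | inj₂ j with refl ← eq =
    _ , j , combine-quotient-remainder (sym (splitAt⁻¹-↑ʳ split≡)) , refl

  source-monoˡ : Monotoneˡ source
  source-monoˡ i<j si sj with source-inj₁ si | source-inj₁ sj
  ... | _ , _ , refl , refl | _ , _ , refl , refl = combine-reflects-< {m = n} (↑ˡ-reflects-< {M′ = l}) i<j

  source-monoʳ : Monotoneʳ source
  source-monoʳ i<j si sj with source-inj₂ si | source-inj₂ sj
  ... | _ , _ , refl , refl | _ , _ , refl , refl = combine-reflects-< {m = n} (↑ʳ-reflects-< {M′ = k}) i<j

  Admissible-antitone : {α α′ : Partition (n * k)} {β β′ : Partition (n * l)} →
                        NonCrossing α′ → NonCrossing β′ → Refines α′ α → Refines β′ β →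
                        Admissible n k l α β → Admissible n k l α′ β′
  Admissible-antitone {α} {α′} {β} {β′} nc-α′ nc-β′ α′∣α β′∣β =
    NonCrossing-resp-≗ (sym ∘ shuffle-source α′ β′)
    ∘ NonCrossing-pullback-refine source source-monoˡ source-monoʳ nc-α′ nc-β′ α′∣α β′∣β
    ∘ NonCrossing-resp-≗ (shuffle-source α β)

lemma3p12 : (n k l : ℕ) (α α′ : Partition (n * k)) (β β′ : Partition (n * l)) →
            NonCrossing α → NonCrossing α′ → NonCrossing β → NonCrossing β′ →
            ((Admissible n k l α β → Refines α′ α → Refines β′ β → Admissible n k l α′ β′)
             × (¬ Admissible n k l α β → Refines α α′ → Refines β β′ → ¬ Admissible n k l α′ β′))
lemma3p12 n k l α α′ β β′ nc-α nc-α′ nc-β nc-β′ =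
  (λ adm α′∣α β′∣β → Admissible-antitone n k l nc-α′ nc-β′ α′∣α β′∣β adm) ,
  (λ ¬adm α∣α′ β∣β′ → ¬adm ∘ Admissible-antitone n k l nc-α nc-β α∣α′ β∣β′)
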